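{- Let $G=(V,E)$ be a graph and $\mathcal S=(S(v))_{v\in V}$ a sequence of sets of labels. Given $u\in V$, let $\mathcal S'$ be obtained from $\mathcal S$ by replacing $S(u)$ with some set $S'(u)\subseteq\mathbb N$. Let $i\ge0$ be an integer and let $w\in V$ be a vertex whose colours at time $i$ with respect to $\mathcal S$ and $\mathcal S'$ differ. Then there is a path $\mathcal P$ from $u$ to $w$ in $G$ such that every vertex of $\mathcal P$, except possibly $w$, gained or lost a relevant label less than or equal to $i$ when $\mathcal S$ was replaced by $\mathcal S'$; moreover, the relevant labels gained or lost by the vertices along $\mathcal P$ are in strictly increasing order when $\mathcal P$ is traversed from $u$ to $w$.
   Context: A sequence of sets of labels assigns to each vertex $v$ a set $S(v)\subseteq\mathbb N=\{0,1,2,\dots\}$. Relevant labels are defined inductively: label $i$ is relevant for $v$ if (I) $i=0\in S(v)$, or (II) $i\in S(v)$, every $j<i$ is irrelevant for $v$, and exactly one neighbour of $v$ has a relevant label strictly smaller than $i$. Let $R_{\le l}$ be the set of vertices having a relevant label $\le l$. The colouring at time $l$: $u$ is purple if $u\in R_{\le l}$; otherwise white if no neighbour of $u$ is in $R_{\le l}$, blue if exactly one is, orange if at least two are. A vertex "gains or loses" a relevant label $j$ when $j$ is relevant for it with respect to exactly one of $\mathcal S,\mathcal S'$. -}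

module Defs where

open import Data.Nat using (ℕ; zero; suc; _+_; _≤_; _<_; _≡ᵇ_)
open import Data.Bool using (Bool; true; false; _∧_; _∨_; not; if_then_else_)
open import Data.Fin using (Fin; _≟_; fromℕ; inject₁) renaming (zero to fzero; suc to fsuc; _<_ to _<ᶠ_)
open import Data.List using (List; map)
open import Data.Nat.ListAction using (sum)
open import Data.List.Base using (allFin)
open import Data.Product using (Σ; _×_; ∃)
open import Relation.Binary.PropositionalEquality using (_≡_; _≢_)
open import Relation.Nullary.Decidable using (⌊_⌋)
open import Function.Definitions using (Injective)

record Graph (n : ℕ) : Set where
  field
    adj     : Fin n → Fin n → Bool
    sym     : ∀ x y → adj x y ≡ adj y x
    irrefl  : ∀ x → adj x x ≡ false
open Graph public

-- A sequence of sets of labels: S v is (the characteristic function of) S(v) ⊆ ℕ.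
Labels : ℕ → Set
Labels n = Fin n → ℕ → Bool

countV : ∀ {n} → (Fin n → Bool) → ℕ
countV {n} P = sum (map (λ x → if P x then 1 else 0) (allFin n))

nbrCount : ∀ {n} → Graph n → (Fin n → Bool) → Fin n → ℕ
nbrCount G P v = countV (λ x → adj G v x ∧ P x)

mutual
  isRel : ∀ {n} → Graph n → Labels n → ℕ → Fin n → Bool
  isRel G S i v =
    S v i ∧ ((i ≡ᵇ 0) ∨ (not (hasRelBelow G S i v) ∧ (nbrCount G (hasRelBelow G S i) v ≡ᵇ 1)))

  hasRelBelow : ∀ {n} → Graph n → Labels n → ℕ → Fin n → Bool
  hasRelBelow G S zero    v = false
  hasRelBelow G S (suc k) v = hasRelBelow G S k v ∨ isRel G S k v

inR≤ : ∀ {n} → Graph n → Labels n → ℕ → Fin n → Bool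
inR≤ G S l = hasRelBelow G S (suc l)

data Colour : Set where
  purple white blue orange : Colour

colourOfCount : ℕ → Colour
colourOfCount zero          = white
colourOfCount (suc zero)    = blue
colourOfCount (suc (suc _)) = orange

colour : ∀ {n} → Graph n → Labels n → ℕ → Fin n → Colour
colour G S l x =
  if inR≤ G S l x then purple else colourOfCount (nbrCount G (inR≤ G S l) x)

replace : ∀ {n} → Labels n → Fin n → (ℕ → Bool) → Labels n
replace S u T v = if ⌊ v ≟ u ⌋ then T else S v

GainsOrLoses : ∀ {n} → Graph n → Labels n → Labels n → ℕ → Fin n → Set
GainsOrLoses G S S' j v = isRel G S j v ≢ isRel G S' j v

-- A path u = p 0, p 1, ..., p k = w (distinct vertices, consecutive adjacent),
-- with labels ℓ 0 < ℓ 1 < ... < ℓ (k-1) ≤ i, where p t gains or loses ℓ t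
-- for every t < k (i.e. every vertex except possibly w).
GoodPath : ∀ {n} → Graph n → Labels n → Labels n → ℕ → Fin n → Fin n → Set
GoodPath {n} G S S' i u w =
  Σ ℕ λ k → Σ (Fin (suc k) → Fin n) λ p → Σ (Fin k → ℕ) λ ℓ →
    (p fzero ≡ u) × (p (fromℕ k) ≡ w) × Injective _≡_ _≡_ p ×
    (∀ t → adj G (p (inject₁ t)) (p (fsuc t)) ≡ true) ×
    (∀ t → ℓ t ≤ i × GainsOrLoses G S S' (ℓ t) (p (inject₁ t))) ×
    (∀ s t → s <ᶠ t → ℓ s < ℓ t)

-- Relevance of label j at v depends only on S v j, on v's own relevant labels below j and on
-- how many neighbours have a relevant label below j; the colour at time i depends likewise on
-- labels ≤ i at the vertex and its neighbours.  Hence, away from u, every change is caused by a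
-- strictly earlier change at the vertex itself or at a neighbour.  Following these causes
-- backwards by strong induction on the label reaches u, and shortcutting repeated vertices
-- turns the resulting walk into a path along which the labels strictly increase.
module Submission where

open import Defs
open import Data.Nat using (ℕ; zero; suc; _+_; _≤_; _<_; s≤s; _≡ᵇ_)
open import Data.Nat.Properties using (≤-refl; ≤-trans; <⇒≤; ≤-pred; n≤1+n; m≤n⇒m≤1+n)
import Data.Nat.Properties as ℕ
open import Data.Nat.Induction using (<-rec)
open import Data.Bool using (Bool; true; false; _∧_; _∨_; not; if_then_else_)
import Data.Bool.Properties as Bool
open import Data.Fin using (Fin; fromℕ; inject₁; _≟_) renaming (zero to fzero; suc to fsuc; _<_ to _<ᶠ_)
open import Data.List using (List; []; _∷_; map; allFin)
open import Data.Nat.ListAction using (sum)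
open import Data.List.Relation.Unary.Any using (here; there)
open import Data.List.Membership.Propositional using (_∈_; _∉_)
open import Data.Product using (∃; ∃-syntax; _×_; _,_; proj₂)
open import Data.Sum using (_⊎_; inj₁; inj₂)
open import Data.Empty using (⊥-elim)
open import Relation.Nullary using (¬_; yes; no)
open import Relation.Binary.PropositionalEquality using (_≡_; _≢_; refl; cong; cong₂; subst)
  renaming (sym to ≡-sym)
open import Function.Definitions using (Injective)

sum-indicator-≢⇒∃-≢ : ∀ {A : Set} (P Q : A → Bool) (xs : List A) →
  sum (map (λ x → if P x then 1 else 0) xs) ≢ sum (map (λ x → if Q x then 1 else 0) xs) →
  ∃[ x ] P x ≢ Q x
sum-indicator-≢⇒∃-≢ P Q []       d = ⊥-elim (d refl)
sum-indicator-≢⇒∃-≢ P Q (x ∷ xs) d with P x Bool.≟ Q x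
... | no  Px≢Qx = x , Px≢Qx
... | yes Px≡Qx = sum-indicator-≢⇒∃-≢ P Q xs λ e →
  d (cong₂ _+_ (cong (λ b → if b then 1 else 0) Px≡Qx) e)

nbrCount-≢⇒∃-neighbour-≢ : ∀ {n} (G : Graph n) (H H' : Fin n → Bool) (v : Fin n) →
  nbrCount G H v ≢ nbrCount G H' v → ∃[ x ] adj G v x ≡ true × H x ≢ H' x
nbrCount-≢⇒∃-neighbour-≢ {n} G H H' v d
  with sum-indicator-≢⇒∃-≢ (λ x → adj G v x ∧ H x) (λ x → adj G v x ∧ H' x) (allFin n) d
... | x , Hx≢H'x with adj G v x in vx
...   | true  = x , vx , Hx≢H'x
...   | false = ⊥-elim (Hx≢H'x refl)

module _ {n} (G : Graph n) (S S' : Labels n) where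

  ChangedBelow : ℕ → Fin n → Set
  ChangedBelow j v = ∃[ j' ] j' < j × GainsOrLoses G S S' j' v

  hasRelBelow-≢⇒changedBelow : ∀ j v →
    hasRelBelow G S j v ≢ hasRelBelow G S' j v → ChangedBelow j v
  hasRelBelow-≢⇒changedBelow zero    v d = ⊥-elim (d refl)
  hasRelBelow-≢⇒changedBelow (suc j) v d with isRel G S j v Bool.≟ isRel G S' j v
  ... | no  gol = j , ≤-refl , gol
  ... | yes same with hasRelBelow-≢⇒changedBelow j v (λ e → d (cong₂ _∨_ e same))
  ...   | j' , j'<j , gol = j' , m≤n⇒m≤1+n j'<j , gol

  Disturbed : ℕ → Fin n → Set
  Disturbed j v = ChangedBelow j v ⊎ ∃[ x ] adj G v x ≡ true × ChangedBelow j x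

  disturbed : ∀ j v →
    ¬ (hasRelBelow G S j v ≡ hasRelBelow G S' j v ×
       nbrCount G (hasRelBelow G S j) v ≡ nbrCount G (hasRelBelow G S' j) v) →
    Disturbed j v
  disturbed j v d with hasRelBelow G S j v Bool.≟ hasRelBelow G S' j v
  ... | no  own = inj₁ (hasRelBelow-≢⇒changedBelow j v own)
  ... | yes own with nbrCount G (hasRelBelow G S j) v ℕ.≟ nbrCount G (hasRelBelow G S' j) v
  ...   | yes count = ⊥-elim (d (own , count))
  ...   | no  count with nbrCount-≢⇒∃-neighbour-≢ G _ _ v count
  ...     | x , vx , changed = inj₂ (x , vx , hasRelBelow-≢⇒changedBelow j x changed)

  gainsOrLoses⇒disturbed : ∀ j v → S v j ≡ S' v j → GainsOrLoses G S S' j v → Disturbed j v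
  gainsOrLoses⇒disturbed j v label gol = disturbed j v λ (own , count) →
    gol (cong₂ _∧_ label (cong₂ (λ b c → (j ≡ᵇ 0) ∨ (not b ∧ (c ≡ᵇ 1))) own count))

  colour-≢⇒disturbed : ∀ i w → colour G S i w ≢ colour G S' i w → Disturbed (suc i) w
  colour-≢⇒disturbed i w d = disturbed (suc i) w λ (own , count) →
    d (cong₂ (λ a c → if a then purple else colourOfCount c) own count)

module _ {n} (G : Graph n) (S S' : Labels n) (u : Fin n)
         (agree : ∀ v → v ≢ u → S v ≡ S' v) where

  open import Data.List.Membership.DecPropositional (_≟_ {n}) using (_∈?_)

  -- Chain b v ys: a path from u to v whose earlier vertices, listed from v backwards, are ys;
  -- each of them gains or loses a label, these labels increase towards v and are all < b.
  data Chain : ℕ → Fin n → List (Fin n) → Set where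
    start  : ∀ {b} → Chain b u []
    extend : ∀ {b l y ys v} → Chain l y ys → GainsOrLoses G S S' l y → l < b →
             adj G y v ≡ true → v ∉ y ∷ ys → Chain b v (y ∷ ys)

  chain-fresh : ∀ {b v ys} → Chain b v ys → v ∉ ys
  chain-fresh start               ()
  chain-fresh (extend _ _ _ _ v∉) = v∉

  chain-weaken : ∀ {b b' v ys} → b ≤ b' → Chain b v ys → Chain b' v ys
  chain-weaken b≤b' start                   = start
  chain-weaken b≤b' (extend c gol l<b a v∉) = extend c gol (≤-trans l<b b≤b') a v∉

  chain-cut : ∀ {b x v ys} → Chain b x ys → v ∈ x ∷ ys → ∃ (Chain b v)
  chain-cut c                    (here refl) = _ , c
  chain-cut (extend c _ l<b _ _) (there v∈) with chain-cut c v∈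
  ... | _ , c' = _ , chain-weaken (<⇒≤ l<b) c'

  chain-extend : ∀ {b l x ys v} → Chain l x ys → GainsOrLoses G S S' l x → l < b →
                 adj G v x ≡ true → ∃ (Chain b v)
  chain-extend {v = v} c gol l<b vx with v ∈? (_ ∷ _)
  ... | yes v∈ with chain-cut c v∈
  ...   | _ , c' = _ , chain-weaken (<⇒≤ l<b) c'
  chain-extend {x = x} {v = v} c gol l<b vx | no v∉ =
    _ , extend c gol l<b (subst (_≡ true) (Graph.sym G v x) vx) v∉

  ChainsBelow : ℕ → Set
  ChainsBelow b = ∀ {j} → j < b → ∀ v → GainsOrLoses G S S' j v → ∃ (Chain j v)

  disturbed⇒chain : ∀ {b v} → ChainsBelow b → Disturbed G S S' b v → ∃ (Chain b v)
  disturbed⇒chain chains (inj₁ (j , j<b , gol)) with chains j<b _ gol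
  ... | _ , c = _ , chain-weaken (<⇒≤ j<b) c
  disturbed⇒chain chains (inj₂ (x , vx , j , j<b , gol)) with chains j<b x gol
  ... | _ , c = chain-extend c gol j<b vx

  gainsOrLoses⇒chain : ∀ j v → GainsOrLoses G S S' j v → ∃ (Chain j v)
  gainsOrLoses⇒chain = <-rec (λ j → ∀ v → GainsOrLoses G S S' j v → ∃ (Chain j v)) step
    where
    step : ∀ j → ChainsBelow j → ∀ v → GainsOrLoses G S S' j v → ∃ (Chain j v)
    step j chains v gol with v ≟ u
    ... | yes refl = _ , start
    ... | no  v≢u  = disturbed⇒chain chains
                       (gainsOrLoses⇒disturbed G S S' j v (cong (λ s → s j) (agree v v≢u)) gol)

  chainsBelow : ∀ b → ChainsBelow b
  chainsBelow b _ = gainsOrLoses⇒chain _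

  module _ (i : ℕ) where

    record IncreasingPath (lo : ℕ) (a w : Fin n) : Set where
      field
        k     : ℕ
        p     : Fin (suc k) → Fin n
        ℓ     : Fin k → ℕ
        begins : p fzero ≡ a
        ends   : p (fromℕ k) ≡ w
        inj   : Injective _≡_ _≡_ p
        adjs  : ∀ t → adj G (p (inject₁ t)) (p (fsuc t)) ≡ true
        labs  : ∀ t → ℓ t ≤ i × GainsOrLoses G S S' (ℓ t) (p (inject₁ t))
        incr  : ∀ s t → s <ᶠ t → ℓ s < ℓ t
        low   : ∀ t → lo ≤ ℓ t

    trivialPath : ∀ lo w → IncreasingPath lo w w
    trivialPath lo w = record
      { k = 0 ; p = λ _ → w ; ℓ = λ () ; begins = refl ; ends = refl
      ; inj = λ { {fzero} {fzero} _ → refl }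
      ; adjs = λ () ; labs = λ () ; incr = λ () ; low = λ () }

    prepend : ∀ {lo l y a w} (P : IncreasingPath lo a w) →
      GainsOrLoses G S S' l y → l ≤ i → l < lo → adj G y a ≡ true →
      (∀ t → IncreasingPath.p P t ≢ y) → IncreasingPath l y w
    prepend {lo} {l} {y} P gol l≤i l<lo ya fresh = record
      { k = suc k ; p = p' ; ℓ = ℓ' ; begins = refl ; ends = ends ; inj = inj'
      ; adjs = adjs' ; labs = labs' ; incr = incr' ; low = low' }
      where
      open IncreasingPath P
      p' : Fin (suc (suc k)) → Fin n
      p' fzero    = y
      p' (fsuc t) = p t
      ℓ' : Fin (suc k) → ℕ
      ℓ' fzero    = l
      ℓ' (fsuc t) = ℓ t
      inj' : Injective _≡_ _≡_ p'
      inj' {fzero}  {fzero}  _ = refl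
      inj' {fzero}  {fsuc t} e = ⊥-elim (fresh t (≡-sym e))
      inj' {fsuc s} {fzero}  e = ⊥-elim (fresh s e)
      inj' {fsuc s} {fsuc t} e = cong fsuc (inj e)
      adjs' : ∀ t → adj G (p' (inject₁ t)) (p' (fsuc t)) ≡ true
      adjs' fzero    = subst (λ z → adj G y z ≡ true) (≡-sym begins) ya
      adjs' (fsuc t) = adjs t
      labs' : ∀ t → ℓ' t ≤ i × GainsOrLoses G S S' (ℓ' t) (p' (inject₁ t))
      labs' fzero    = l≤i , gol
      labs' (fsuc t) = labs t
      incr' : ∀ s t → s <ᶠ t → ℓ' s < ℓ' t
      incr' fzero    (fsuc t) _       = ≤-trans l<lo (low t)
      incr' (fsuc s) (fsuc t) (s≤s h) = incr s t h
      low' : ∀ t → l ≤ ℓ' t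
      low' fzero    = ≤-refl
      low' (fsuc t) = ≤-trans (<⇒≤ l<lo) (low t)

    -- The chain is consumed from its far end, so the path is built by prepending.
    chain⇒path : ∀ {b x ys w} → Chain b x ys → b ≤ suc i → (P : IncreasingPath b x w) →
      (∀ t → IncreasingPath.p P t ∉ ys) → GoodPath G S S' i u w
    chain⇒path start _ P _ = k , p , ℓ , begins , ends , inj , adjs , labs , incr
      where open IncreasingPath P
    chain⇒path (extend {l = l} {y} {ys} c gol l<b ya y∉) b≤1+i P disjoint =
      chain⇒path c (≤-trans (n≤1+n l) l<1+i) P' disjoint'
      where
      l<1+i : l < suc i
      l<1+i = ≤-trans l<b b≤1+i
      P' : IncreasingPath l y _
      P' = prepend P gol (≤-pred l<1+i) l<b ya (λ t e → disjoint t (here e))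
      disjoint' : ∀ t → IncreasingPath.p P' t ∉ ys
      disjoint' fzero    = chain-fresh c
      disjoint' (fsuc t) = λ t∈ys → disjoint t (there t∈ys)

    chain⇒goodPath : ∀ {w ys} → Chain (suc i) w ys → GoodPath G S S' i u w
    chain⇒goodPath {w} c = chain⇒path c ≤-refl (trivialPath _ w) (λ _ → chain-fresh c)

replace-agree : ∀ {n} (S : Labels n) (u : Fin n) (T : ℕ → Bool) →
  ∀ v → v ≢ u → S v ≡ replace S u T v
replace-agree S u T v v≢u with v ≟ u
... | yes v≡u = ⊥-elim (v≢u v≡u)
... | no  _   = refl

lemma3p1 : ∀ {n} (G : Graph n) (S : Labels n) (u : Fin n) (T : ℕ → Bool) (i : ℕ) (w : Fin n) →
    colour G S i w ≢ colour G (replace S u T) i w →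
    GoodPath G S (replace S u T) i u w
lemma3p1 G S u T i w d = chain⇒goodPath G S S' u agree i (proj₂ chain)
  where
  S' : Labels _
  S' = replace S u T
  agree : ∀ v → v ≢ u → S v ≡ S' v
  agree = replace-agree S u T
  chain : ∃ (Chain G S S' u agree (suc i) w)
  chain = disturbed⇒chain G S S' u agree (chainsBelow G S S' u agree (suc i))
            (colour-≢⇒disturbed G S S' i w d)
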